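{- Let $p$ be a prime, $n\geq 1$ an integer and $\alpha\in\mathbb{Q}_p^n$. Then the $p$-adic Ducci sequence $(D_p^k(\alpha))_{k\geq 0}$ is ultimately periodic: there exist integers $r\geq 1$ and $s\geq 1$ such that $D_p^{k+s}(\alpha)=D_p^{k}(\alpha)$ for all $k\geq r$.
   Context: For $x\in\mathbb{Q}_p$, $|x|_p=p^{ -\mathrm{ord}_p(x)}$ for $x\neq 0$ (where $\mathrm{ord}_p(x)$ is the $p$-adic valuation of $x$) and $|0|_p=0$. Let $P=\{0\}\cup\{p^i : i\in\mathbb{Z}\}$. The $p$-adic Ducci operator is $D_p:\mathbb{Q}_p^n\to P^n$, $D_p(a_1,\dots,a_n)=(|a_1-a_2|_p,|a_2-a_3|_p,\dots,|a_{n-1}-a_n|_p,|a_n-a_1|_p)$, and $D_p^k$ denotes its $k$-fold iterate ($D_p^0$ the identity). The $p$-adic Ducci sequence generated by the seed $\alpha$ is $(D_p^k(\alpha))_{k\geq 0}$. -}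

module Defs where

open import Data.Nat using (ℕ; zero; suc; _+_; _*_; _∸_; _^_; _≤_; _<_; _<?_; s≤s; NonZero; _%_)
open import Data.Nat.Properties using (m^n≢0)
open import Data.Integer using (ℤ; +_; -[1+_]) renaming (_-_ to _-ℤ_)
open import Data.Fin using (Fin; zero; suc; toℕ; fromℕ<)
open import Data.Vec using (Vec; lookup; map)
open import Data.Product using (Σ; _×_; _,_; proj₁; proj₂)
open import Relation.Nullary using (¬_; yes; no)
open import Relation.Binary.PropositionalEquality using (_≡_)

modPow : (p : ℕ) .{{_ : NonZero p}} → ℕ → ℕ → ℕ
modPow p k a = _%_ a (p ^ k) {{m^n≢0 p k}}

-- p-adic integers as the inverse limit  Z_p = lim Z/p^k Z :
-- a sequence x k ∈ {0,…,p^k - 1} with x (k+1) ≡ x k (mod p^k).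
-- p-adic numbers: Q_p = { x / p^m : x ∈ Z_p, m ∈ ℕ }, represented by a
-- pair (x , m).  'QpRaw' is the underlying data without coherence proofs.

QpRaw : Set
QpRaw = (ℕ → ℕ) × ℕ

module _ (p : ℕ) .{{_ : NonZero p}} where

  IsZpSeq : (ℕ → ℕ) → Set
  IsZpSeq x = (∀ k → x k < p ^ k) × (∀ k → modPow p k (x (suc k)) ≡ x k)

  Qp : Set
  Qp = Σ QpRaw (λ a → IsZpSeq (proj₁ a))

  shiftZp : ℕ → (ℕ → ℕ) → (ℕ → ℕ)
  shiftZp j x k = modPow p k (p ^ j * x (k ∸ j))

  -- (x / p^m) - (y / p^m') = (p^m' x - p^m y) / p^(m + m')
  diffNum : QpRaw → QpRaw → (ℕ → ℕ)
  diffNum (x , m) (y , m') k =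
    modPow p k (shiftZp m' x k + p ^ k ∸ shiftZp m y k)

  diffDen : QpRaw → QpRaw → ℕ
  diffDen (x , m) (y , m') = m + m'

data P : Set where
  zeroP : P
  powP  : ℤ → P      -- powP i stands for p^i

module _ (p : ℕ) .{{_ : NonZero p}} where

  embedP : P → QpRaw
  embedP zeroP          = ((λ k → 0) , 0)
  embedP (powP (+ i))   = ((λ k → modPow p k (p ^ i)) , 0)
  embedP (powP -[1+ i ]) = ((λ k → modPow p k 1) , suc i)

  -- |d / p^M|_p = v   (d a p-adic integer sequence)
  -- d = 0 gives 0; ord_p(d) = v gives p^(-(v - M)) = p^(M - v).
  data AbsIs (d : ℕ → ℕ) (M : ℕ) : P → Set where
    absZero : (∀ k → d k ≡ 0) → AbsIs d M zeroP
    absOrd  : ∀ v → d v ≡ 0 → ¬ (d (suc v) ≡ 0) →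
              AbsIs d M (powP ((+ M) -ℤ (+ v)))

  AbsDiffIs : QpRaw → QpRaw → P → Set
  AbsDiffIs a b v = AbsIs (diffNum p a b) (diffDen p a b) v

next : ∀ {n} → Fin n → Fin n
next {suc m} i with suc (toℕ i) <? suc m
... | yes lt = fromℕ< lt
... | no _   = zero

module _ (p : ℕ) .{{_ : NonZero p}} where

  DucciRel : ∀ {n} → Vec QpRaw n → Vec P n → Set
  DucciRel a b = ∀ i → AbsDiffIs p (lookup a i) (lookup a (next i)) (lookup b i)

{-# OPTIONS --safe #-}
module Submission where

-- On P the p-adic distance is explicit: |p^z - p^w|_p = p^(-min(z, w)) for
-- z ≠ w, and |p^z - 0|_p = p^(-z).  So from the first step on, the Ducci
-- sequence is the orbit of a map on P^n whose entries are 0 or negatives of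
-- entries of the previous vector.  All terms therefore lie in the finite set
-- built from the entries of D_p(α), their negatives and 0, and an orbit of a
-- map in a finite set is eventually periodic.

open import Data.Nat
  using (ℕ; zero; suc; _+_; _*_; _∸_; _^_; _≤_; _<_; z≤n; s≤s; s≤s⁻¹;
         NonZero; nonTrivial⇒n>1)
open import Data.Nat.Properties
open import Data.Nat.DivMod
  using (_%_; _/_; m≡m%n+[m/n]*n; m%n<n; m<n⇒m%n≡m; n%n≡0; [m+n]%n≡m%n; %-remove-+ʳ)
open import Data.Nat.Divisibility
  using (_∣_; divides; _∣0; ∣-trans; ∣⇒≤; n∣m*n; ∣m⇒∣m*n; *-monoʳ-∣;
         n∣m⇒m%n≡0; m%n≡0⇒n∣m; %-presˡ-∣; ∣n∣m%n⇒∣m)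
open import Data.Nat.Primality using (Prime; prime⇒nonTrivial)
open import Data.Integer as ℤ using (ℤ; +_; -[1+_]; _⊖_) renaming (_-_ to _-ℤ_)
import Data.Integer.Properties as ℤ
open import Data.Fin as Fin using (toℕ)
open import Data.Fin.Properties using (pigeonhole)
open import Data.List as List using (List; _++_; cartesianProductWith)
open import Data.List.Membership.Propositional using (_∈_)
open import Data.List.Membership.Propositional.Properties
  using (∈-map⁺; ∈-map⁻; ∈-++⁺ˡ; ∈-++⁺ʳ; ∈-++⁻; ∈-cartesianProductWith⁺)
open import Data.List.Relation.Unary.Any using (here; there; index)
open import Data.List.Relation.Unary.Any.Properties using (lookup-index)
open import Data.Vec using (Vec; []; _∷_; lookup; map; tabulate; toList)
open import Data.Vec.Properties using (lookup-map; lookup∘tabulate; tabulate∘lookup; tabulate-cong)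
open import Data.Vec.Membership.Propositional.Properties using (∈-lookup; ∈-toList⁺)
open import Data.Product using (Σ; _×_; _,_; proj₁; proj₂)
open import Data.Sum using (inj₁; inj₂)
open import Function using (_∘_)
open import Function.Bundles using (_⇔_; mk⇔; Equivalence)
open import Function.Construct.Composition using (_⇔-∘_)
open import Relation.Nullary using (yes; no; contradiction)
open import Relation.Binary.Definitions using (tri<; tri≈; tri>)
open import Relation.Binary.PropositionalEquality
open import Defs

open Equivalence using (to; from)

-- embedP p (powP z) is the fraction p ^ numExp z / p ^ denExp z.
numExp : ℤ → ℕ
numExp (+ i)    = i
numExp -[1+ i ] = 0

denExp : ℤ → ℕ
denExp (+ i)    = 0
denExp -[1+ i ] = suc i

numExp⊖denExp : ∀ c z → (c + numExp z) ⊖ (c + denExp z) ≡ z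
numExp⊖denExp c (+ i)    = trans (ℤ.+-cancelˡ-⊖ c i 0) (ℤ.⊖-≥ z≤n)
numExp⊖denExp c -[1+ i ] = ℤ.+-cancelˡ-⊖ c 0 (suc i)

numExp⊖denExp′ : ∀ c z → (c + numExp z) ⊖ (denExp z + c) ≡ z
numExp⊖denExp′ c z = trans (cong ((c + numExp z) ⊖_) (+-comm (denExp z) c)) (numExp⊖denExp c z)

negP : P → P
negP zeroP    = zeroP
negP (powP z) = powP (ℤ.- z)

negP-involutive : ∀ a → negP (negP a) ≡ a
negP-involutive zeroP    = refl
negP-involutive (powP z) = cong powP (ℤ.neg-involutive z)

absDiffP : P → P → P
absDiffP zeroP    b        = negP b
absDiffP (powP z) zeroP    = powP (ℤ.- z)
absDiffP (powP z) (powP w) with ℤ.<-cmp z w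
... | tri< _ _ _ = powP (ℤ.- z)
... | tri≈ _ _ _ = zeroP
... | tri> _ _ _ = powP (ℤ.- w)

absDiffP-< : ∀ {z w} → z ℤ.< w → absDiffP (powP z) (powP w) ≡ powP (ℤ.- z)
absDiffP-< {z} {w} z<w with ℤ.<-cmp z w
... | tri< _ _ _      = refl
... | tri≈ z≮w _ _    = contradiction z<w z≮w
... | tri> z≮w _ _    = contradiction z<w z≮w

absDiffP-≡ : ∀ z → absDiffP (powP z) (powP z) ≡ zeroP
absDiffP-≡ z with ℤ.<-cmp z z
... | tri< _ z≢z _ = contradiction refl z≢z
... | tri≈ _ _ _   = refl
... | tri> _ z≢z _ = contradiction refl z≢z

absDiffP-> : ∀ {z w} → w ℤ.< z → absDiffP (powP z) (powP w) ≡ powP (ℤ.- w)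
absDiffP-> {z} {w} w<z with ℤ.<-cmp z w
... | tri< _ _ w≮z    = contradiction w<z w≮z
... | tri≈ _ _ w≮z    = contradiction w<z w≮z
... | tri> _ _ _      = refl

absDiffP∈ : ∀ a b → absDiffP a b ∈ zeroP List.∷ negP a List.∷ negP b List.∷ List.[]
absDiffP∈ zeroP    b        = there (there (here refl))
absDiffP∈ (powP z) zeroP    = there (here refl)
absDiffP∈ (powP z) (powP w) with ℤ.<-cmp z w
... | tri< _ _ _ = there (here refl)
... | tri≈ _ _ _ = here refl
... | tri> _ _ _ = there (there (here refl))

ducciP : ∀ {n} → Vec P n → Vec P n
ducciP b = tabulate (λ i → absDiffP (lookup b i) (lookup b (next i)))

negClosure : List P → List P
negClosure xs = zeroP List.∷ xs ++ List.map negP xs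

negP-∈-negClosure : ∀ xs {a} → a ∈ negClosure xs → negP a ∈ negClosure xs
negP-∈-negClosure xs (here refl) = here refl
negP-∈-negClosure xs (there a∈) with ∈-++⁻ xs a∈
... | inj₁ a∈xs = there (∈-++⁺ʳ xs (∈-map⁺ negP a∈xs))
... | inj₂ a∈negs with ∈-map⁻ negP a∈negs
...   | b , b∈xs , refl = there (∈-++⁺ˡ (subst (_∈ xs) (sym (negP-involutive b)) b∈xs))

absDiffP-∈-negClosure : ∀ xs {a b} → a ∈ negClosure xs → b ∈ negClosure xs →
                        absDiffP a b ∈ negClosure xs
absDiffP-∈-negClosure xs {a} {b} a∈ b∈ = candidate∈ (absDiffP∈ a b)
  where
  candidate∈ : ∀ {c} → c ∈ zeroP List.∷ negP a List.∷ negP b List.∷ List.[] →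
               c ∈ negClosure xs
  candidate∈ (here refl)                 = here refl
  candidate∈ (there (here refl))         = negP-∈-negClosure xs a∈
  candidate∈ (there (there (here refl))) = negP-∈-negClosure xs b∈

ducciP-∈-negClosure : ∀ xs {n} (b : Vec P n) → (∀ i → lookup b i ∈ negClosure xs) →
                      ∀ i → lookup (ducciP b) i ∈ negClosure xs
ducciP-∈-negClosure xs b b∈ i =
  subst (_∈ negClosure xs) (sym (lookup∘tabulate _ i))
    (absDiffP-∈-negClosure xs (b∈ i) (b∈ (next i)))

vecsOver : ∀ {A : Set} → List A → (n : ℕ) → List (Vec A n)
vecsOver xs zero    = [] List.∷ List.[]
vecsOver xs (suc n) = cartesianProductWith _∷_ xs (vecsOver xs n)

∈-vecsOver : ∀ {A : Set} {xs : List A} {n} (v : Vec A n) →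
             (∀ i → lookup v i ∈ xs) → v ∈ vecsOver xs n
∈-vecsOver []      _  = here refl
∈-vecsOver (x ∷ v) v∈ = ∈-cartesianProductWith⁺ _∷_ (v∈ Fin.zero) (∈-vecsOver v (v∈ ∘ Fin.suc))

EventuallyPeriodic : ∀ {A : Set} → (ℕ → A) → Set
EventuallyPeriodic β = Σ ℕ λ r → Σ ℕ λ s → 1 ≤ s × (∀ j → r ≤ j → β (j + s) ≡ β j)

module _ {A : Set} (f : A → A) (β : ℕ → A) (β-step : ∀ j → β (suc j) ≡ f (β j)) where

  orbit-cong : ∀ {i j} → β i ≡ β j → ∀ t → β (t + i) ≡ β (t + j)
  orbit-cong     eq zero    = eq
  orbit-cong {i} {j} eq (suc t) =
    trans (β-step (t + i)) (trans (cong f (orbit-cong eq t)) (sym (β-step (t + j))))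

  repeat⇒periodic : ∀ {i s} → β (i + s) ≡ β i → ∀ j → i ≤ j → β (j + s) ≡ β j
  repeat⇒periodic {i} {s} repeat j i≤j = begin
    β (j + s)             ≡⟨ cong (λ k → β (k + s)) (sym (m∸n+n≡m i≤j)) ⟩
    β (j ∸ i + i + s)     ≡⟨ cong β (+-assoc (j ∸ i) i s) ⟩
    β (j ∸ i + (i + s))   ≡⟨ orbit-cong repeat (j ∸ i) ⟩
    β (j ∸ i + i)         ≡⟨ cong β (m∸n+n≡m i≤j) ⟩
    β j                   ∎
    where open ≡-Reasoning

  finite-orbit⇒eventuallyPeriodic : (xs : List A) → (∀ j → β j ∈ xs) → EventuallyPeriodic β
  finite-orbit⇒eventuallyPeriodic xs β∈
    with pigeonhole (n<1+n (List.length xs)) (λ k → index (β∈ (toℕ k)))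
  ... | i , j , i<j , same-index =
    toℕ i , toℕ j ∸ toℕ i , m<n⇒0<n∸m i<j , repeat⇒periodic repeat
    where
    open ≡-Reasoning
    repeat : β (toℕ i + (toℕ j ∸ toℕ i)) ≡ β (toℕ i)
    repeat = begin
      β (toℕ i + (toℕ j ∸ toℕ i))           ≡⟨ cong β (m+[n∸m]≡n (<⇒≤ i<j)) ⟩
      β (toℕ j)                             ≡⟨ lookup-index (β∈ (toℕ j)) ⟩
      List.lookup xs (index (β∈ (toℕ j)))   ≡⟨ cong (List.lookup xs) same-index ⟨
      List.lookup xs (index (β∈ (toℕ i)))   ≡⟨ lookup-index (β∈ (toℕ i)) ⟨
      β (toℕ i)                             ∎

monus-mod≡0⇔ : ∀ q .{{_ : NonZero q}} {u v} → u < q → v < q → (u + q ∸ v) % q ≡ 0 ⇔ u ≡ v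
monus-mod≡0⇔ q {u} {v} u<q v<q = mk⇔ eq⇒ ⇒eq
  where
  open ≡-Reasoning
  eq⇒ : (u + q ∸ v) % q ≡ 0 → u ≡ v
  eq⇒ h = begin
    u                       ≡⟨ m<n⇒m%n≡m u<q ⟨
    u % q                   ≡⟨ [m+n]%n≡m%n u q ⟨
    (u + q) % q             ≡⟨ cong (_% q) (m+[n∸m]≡n (≤-trans (<⇒≤ v<q) (m≤n+m q u))) ⟨
    (v + (u + q ∸ v)) % q   ≡⟨ %-remove-+ʳ v (m%n≡0⇒n∣m _ q h) ⟩
    v % q                   ≡⟨ m<n⇒m%n≡m v<q ⟩
    v                       ∎
  ⇒eq : u ≡ v → (u + q ∸ v) % q ≡ 0
  ⇒eq refl = trans (cong (_% q) (m+n∸m≡n u q)) (n%n≡0 q)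

module _ (p : ℕ) .{{_ : NonZero p}} (1<p : 1 < p) where

  infixl 7 _modp^_
  _modp^_ : ℕ → ℕ → ℕ
  X modp^ k = modPow p k X

  ∣⇒modp^≡0 : ∀ {X} k → p ^ k ∣ X → X modp^ k ≡ 0
  ∣⇒modp^≡0 {X} k = n∣m⇒m%n≡0 X (p ^ k) {{m^n≢0 p k}}

  ^-monoʳ-∣ : ∀ {i j} → i ≤ j → p ^ i ∣ p ^ j
  ^-monoʳ-∣ {i} {j} i≤j =
    divides (p ^ (j ∸ i)) (trans (cong (p ^_) (sym (m∸n+n≡m i≤j))) (^-distribˡ-+-* p (j ∸ i) i))

  pow≡pow*⇔ : ∀ {E V} → p ^ suc E ∣ V → ∀ k → (p ^ E modp^ k ≡ V modp^ k) ⇔ k ≤ E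
  pow≡pow*⇔ {E} {V} p^[1+E]∣V k = mk⇔ ≡⇒≤ ≤⇒≡
    where
    ≡⇒≤ : p ^ E modp^ k ≡ V modp^ k → k ≤ E
    ≡⇒≤ eq with k ≤? E
    ... | yes k≤E = k≤E
    ... | no  k≰E = contradiction (∣⇒≤ p^[1+E]∣p^E) (<⇒≱ (^-monoʳ-< p 1<p (n<1+n E)))
      where
      instance
        p^k≢0 : NonZero (p ^ k)
        p^k≢0 = m^n≢0 p k
        p^E≢0 : NonZero (p ^ E)
        p^E≢0 = m^n≢0 p E
      p^[1+E]∣p^k : p ^ suc E ∣ p ^ k
      p^[1+E]∣p^k = ^-monoʳ-∣ (≰⇒> k≰E)
      p^[1+E]∣p^E : p ^ suc E ∣ p ^ E
      p^[1+E]∣p^E = ∣n∣m%n⇒∣m p^[1+E]∣p^k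
        (subst (p ^ suc E ∣_) (sym eq) (%-presˡ-∣ p^[1+E]∣V p^[1+E]∣p^k))
    ≤⇒≡ : k ≤ E → p ^ E modp^ k ≡ V modp^ k
    ≤⇒≡ k≤E = trans (∣⇒modp^≡0 k (^-monoʳ-∣ k≤E))
      (sym (∣⇒modp^≡0 k (∣-trans (^-monoʳ-∣ (m≤n⇒m≤1+n k≤E)) p^[1+E]∣V)))

  -- d represents the p-adic integer U - V as far as its valuation is concerned.
  DiffZeros : (ℕ → ℕ) → ℕ → ℕ → Set
  DiffZeros d U V = ∀ k → d k ≡ 0 ⇔ (U modp^ k ≡ V modp^ k)

  DiffZeros-sym : ∀ {d U V} → DiffZeros d U V → DiffZeros d V U
  DiffZeros-sym zeros k = mk⇔ (sym ∘ to (zeros k)) (from (zeros k) ∘ sym)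

  Represents : (ℕ → ℕ) → ℕ → Set
  Represents x X = ∀ k → x k ≡ X modp^ k

  shiftZp-represents : ∀ {x X} → Represents x X → ∀ j → Represents (shiftZp p j x) (p ^ j * X)
  shiftZp-represents {x} {X} x≡X j k with ≤-total k j
  ... | inj₁ k≤j = trans (p^k∣⇒≡0 (x (k ∸ j))) (sym (p^k∣⇒≡0 X))
    where
    p^k∣⇒≡0 : ∀ Y → (p ^ j * Y) modp^ k ≡ 0
    p^k∣⇒≡0 Y = ∣⇒modp^≡0 k (∣m⇒∣m*n Y (^-monoʳ-∣ k≤j))
  ... | inj₂ j≤k = begin
    (p ^ j * x (k ∸ j)) modp^ k                       ≡⟨ cong (λ Y → (p ^ j * Y) modp^ k) (x≡X (k ∸ j)) ⟩
    (p ^ j * (X % q)) modp^ k                         ≡⟨ %-remove-+ʳ _ p^k∣ ⟨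
    (p ^ j * (X % q) + p ^ j * (X / q * q)) modp^ k   ≡⟨ cong (_modp^ k) (*-distribˡ-+ (p ^ j) _ _) ⟨
    (p ^ j * (X % q + X / q * q)) modp^ k             ≡⟨ cong (λ Y → (p ^ j * Y) modp^ k) (m≡m%n+[m/n]*n X q) ⟨
    (p ^ j * X) modp^ k                               ∎
    where
    open ≡-Reasoning
    q = p ^ (k ∸ j)
    instance
      p^k≢0 : NonZero (p ^ k)
      p^k≢0 = m^n≢0 p k
      q≢0 : NonZero q
      q≢0 = m^n≢0 p (k ∸ j)
    p^k∣ : p ^ k ∣ p ^ j * (X / q * q)
    p^k∣ = subst (_∣ p ^ j * (X / q * q))
      (trans (sym (^-distribˡ-+-* p j (k ∸ j))) (cong (p ^_) (m+[n∸m]≡n j≤k)))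
      (*-monoʳ-∣ (p ^ j) (n∣m*n (X / q)))

  diffNum-zeros : ∀ {a b : QpRaw} {X Y} → Represents (proj₁ a) X → Represents (proj₁ b) Y →
                  DiffZeros (diffNum p a b) (p ^ proj₂ b * X) (p ^ proj₂ a * Y)
  diffNum-zeros {a} {b} a≡X b≡Y k
    rewrite shiftZp-represents a≡X (proj₂ b) k | shiftZp-represents b≡Y (proj₂ a) k =
    monus-mod≡0⇔ (p ^ k) {{m^n≢0 p k}} (m%n<n _ _ {{m^n≢0 p k}}) (m%n<n _ _ {{m^n≢0 p k}})

  AbsIs-allZero : ∀ {d M v} → (∀ k → d k ≡ 0) → AbsIs p d M v → v ≡ zeroP
  AbsIs-allZero d≡0 (absZero _)              = refl
  AbsIs-allZero d≡0 (absOrd w _ d[1+w]≢0) = contradiction (d≡0 (suc w)) d[1+w]≢0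

  AbsIs-ord : ∀ {d M E v} → (∀ k → d k ≡ 0 ⇔ k ≤ E) → AbsIs p d M v → v ≡ powP (+ M -ℤ + E)
  AbsIs-ord {E = E} zeros (absZero d≡0) = contradiction (to (zeros (suc E)) (d≡0 (suc E))) (n≮n E)
  AbsIs-ord {M = M} {E} zeros (absOrd w dw≡0 d[1+w]≢0) =
    cong (λ e → powP (+ M -ℤ + e))
      (≤-antisym (to (zeros w) dw≡0) (≮⇒≥ (d[1+w]≢0 ∘ from (zeros (suc w)))))

  valuation-pow : ∀ {d M E V v} → DiffZeros d (p ^ E) V → p ^ suc E ∣ V →
                  AbsIs p d M v → v ≡ powP (ℤ.- (E ⊖ M))
  valuation-pow {M = M} {E} zeros p^[1+E]∣V h =
    trans (AbsIs-ord {E = E} (λ k → pow≡pow*⇔ p^[1+E]∣V k ⇔-∘ zeros k) h)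
      (cong powP (trans (ℤ.[+m]-[+n]≡m⊖n M E) (ℤ.⊖-swap M E)))

  valuation-equal : ∀ {d M U v} → DiffZeros d U U → AbsIs p d M v → v ≡ zeroP
  valuation-equal zeros = AbsIs-allZero (λ k → from (zeros k) refl)

  valuation-powers : ∀ {d M E F v} → DiffZeros d (p ^ E) (p ^ F) → AbsIs p d M v →
                     v ≡ absDiffP (powP (E ⊖ M)) (powP (F ⊖ M))
  valuation-powers {M = M} {E} {F} zeros h with <-cmp E F
  ... | tri< E<F _ _ = trans (valuation-pow zeros (^-monoʳ-∣ E<F) h)
                             (sym (absDiffP-< (ℤ.⊖-monoˡ-< M E<F)))
  ... | tri≈ _ refl _ = trans (valuation-equal zeros h) (sym (absDiffP-≡ (E ⊖ M)))
  ... | tri> _ _ F<E = trans (valuation-pow (DiffZeros-sym zeros) (^-monoʳ-∣ F<E) h)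
                             (sym (absDiffP-> (ℤ.⊖-monoˡ-< M F<E)))

  numer : P → ℕ
  numer zeroP    = 0
  numer (powP z) = p ^ numExp z

  denom : P → ℕ
  denom zeroP    = 0
  denom (powP z) = denExp z

  embedP-represents : ∀ a → Represents (proj₁ (embedP p a)) (numer a)
  embedP-represents zeroP            k = sym (∣⇒modp^≡0 k ((p ^ k) ∣0))
  embedP-represents (powP (+ i))     k = refl
  embedP-represents (powP -[1+ i ])  k = refl

  embedP-denom : ∀ a → proj₂ (embedP p a) ≡ denom a
  embedP-denom zeroP           = refl
  embedP-denom (powP (+ i))    = refl
  embedP-denom (powP -[1+ i ]) = refl

  p^[m+n] : ∀ m n → p ^ m * p ^ n ≡ p ^ (m + n)
  p^[m+n] m n = sym (^-distribˡ-+-* p m n)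

  absDiff-from-zeros : ∀ a b {d v} → DiffZeros d (p ^ denom b * numer a) (p ^ denom a * numer b) →
                       AbsIs p d (denom a + denom b) v → v ≡ absDiffP a b
  absDiff-from-zeros zeroP    zeroP    zeros h = valuation-equal zeros h
  absDiff-from-zeros zeroP    (powP w) {d} zeros h =
    trans (valuation-pow (subst₂ (DiffZeros d) (p^[m+n] 0 (numExp w)) (*-zeroʳ (p ^ denExp w))
                           (DiffZeros-sym zeros)) (_ ∣0) h)
      (cong (powP ∘ ℤ.-_) (numExp⊖denExp 0 w))
  absDiff-from-zeros (powP z) zeroP    {d} zeros h =
    trans (valuation-pow (subst₂ (DiffZeros d) (p^[m+n] 0 (numExp z)) (*-zeroʳ (p ^ denExp z))
                           zeros) (_ ∣0) h)
      (cong (powP ∘ ℤ.-_) (numExp⊖denExp′ 0 z))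
  absDiff-from-zeros (powP z) (powP w) {d} zeros h =
    trans (valuation-powers (subst₂ (DiffZeros d) (p^[m+n] (denExp w) (numExp z))
                                                   (p^[m+n] (denExp z) (numExp w)) zeros) h)
      (cong₂ (λ z′ w′ → absDiffP (powP z′) (powP w′))
        (numExp⊖denExp′ (denExp w) z) (numExp⊖denExp (denExp z) w))

  absDiff-embedP : ∀ a b {v} → AbsDiffIs p (embedP p a) (embedP p b) v → v ≡ absDiffP a b
  absDiff-embedP a b {v} h = absDiff-from-zeros a b
    (subst₂ (λ m m′ → DiffZeros d (p ^ m′ * numer a) (p ^ m * numer b))
      (embedP-denom a) (embedP-denom b)
      (diffNum-zeros {embedP p a} {embedP p b} (embedP-represents a) (embedP-represents b)))
    (subst (λ M → AbsIs p d M v) (cong₂ _+_ (embedP-denom a) (embedP-denom b)) h)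
    where
    d : ℕ → ℕ
    d = diffNum p (embedP p a) (embedP p b)

  DucciRel⇒≡ducciP : ∀ {n} (b c : Vec P n) → DucciRel p (map (embedP p) b) c → c ≡ ducciP b
  DucciRel⇒≡ducciP b c rel = trans (sym (tabulate∘lookup c)) (tabulate-cong entry)
    where
    entry : ∀ i → lookup c i ≡ absDiffP (lookup b i) (lookup b (next i))
    entry i = absDiff-embedP (lookup b i) (lookup b (next i))
      (subst₂ (λ x y → AbsDiffIs p x y (lookup c i)) (lookup-map i (embedP p) b)
        (lookup-map (next i) (embedP p) b) (rel i))

mainTheorem2 : (p : ℕ) .{{_ : NonZero p}} → Prime p →
    (n : ℕ) → 1 ≤ n → (α : Vec (Qp p) n) →
    (β : ℕ → Vec P n) →
    DucciRel p (map proj₁ α) (β 0) →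
    (∀ j → DucciRel p (map (embedP p) (β j)) (β (suc j))) →
    Σ ℕ λ r → Σ ℕ λ s → 1 ≤ r × 1 ≤ s ×
    (∀ j → r ≤ suc j → β (j + s) ≡ β j)
-- The hypothesis on α is not needed: the set of entries of β 0 is finite anyway.
mainTheorem2 p p-prime n _ α β _ β-rel =
  reindex (finite-orbit⇒eventuallyPeriodic ducciP β β-step (vecsOver values n)
            (λ j → ∈-vecsOver (β j) (β∈values j)))
  where
  β-step : ∀ j → β (suc j) ≡ ducciP (β j)
  β-step j = DucciRel⇒≡ducciP p (nonTrivial⇒n>1 p {{prime⇒nonTrivial p-prime}})
               (β j) (β (suc j)) (β-rel j)
  values : List P
  values = negClosure (toList (β 0))
  β∈values : ∀ j i → lookup (β j) i ∈ values
  β∈values zero    i = there (∈-++⁺ˡ (∈-toList⁺ (∈-lookup i (β 0))))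
  β∈values (suc j) i = subst (λ b → lookup b i ∈ values) (sym (β-step j))
    (ducciP-∈-negClosure (toList (β 0)) (β j) (β∈values j) i)
  reindex : EventuallyPeriodic β →
            Σ ℕ λ r → Σ ℕ λ s → 1 ≤ r × 1 ≤ s × (∀ j → r ≤ suc j → β (j + s) ≡ β j)
  reindex (r , s , 1≤s , periodic) =
    suc r , s , s≤s z≤n , 1≤s , λ j r≤1+j → periodic j (s≤s⁻¹ r≤1+j)
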